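{- Let $\delta\in(0,1]$ and $\ell\ge0$, and let $f:\mathbb{F}_2^n\to\{ -1,1\}$ be $(\delta,\ell)$-folding with Fourier sparsity $k$ sufficiently large. Define \[ U:=\{\alpha\in\mathcal{S} : \text{there exist at least } \delta k/2 \text{ many } \beta\in\mathcal{S}\setminus\{\alpha\} \text{ with } |O_{\alpha+\beta}|\ge k^\ell+1\}. \] Then $|U|\ge\frac{\delta k}{3}$.
   Context: For $\alpha\in\mathbb{F}_2^n$ let $\chi_\alpha(x)=(-1)^{\sum_i\alpha_ix_i}$; every $f:\mathbb{F}_2^n\to\mathbb{R}$ is uniquely $f=\sum_\alpha\widehat f(\alpha)\chi_\alpha$. The Fourier support is $\mathcal{S}=\{\alpha:\widehat f(\alpha)\ne0\}$ and $k=|\mathcal{S}|$. For $\gamma\in\mathbb{F}_2^n$, $O_\gamma$ is the set of unordered pairs of distinct elements of $\mathcal{S}$ summing to $\gamma$. $f$ is $(\delta,\ell)$-folding if at least $\delta\binom{k}{2}$ unordered pairs $\{\alpha,\beta\}$ of distinct elements of $\mathcal{S}$ satisfy $|O_{\alpha+\beta}|\ge k^\ell+1$.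
   Formalization: The parameters δ and ℓ take rational values only, with $\delta\in(0,1]$ and $\ell\ge0$ as rationals. -}

module Defs where

open import Data.Bool using (Bool; true; false; _xor_; _∧_; if_then_else_)
open import Data.Nat as ℕ using (ℕ; _^_; _∸_)
open import Data.Integer as ℤ using (ℤ; +_; -_)
open import Data.Rational as ℚ using (ℚ; _/_; ↥_; ↧ₙ_)
open import Data.Rational.Properties using (_≤?_; _≟_)
open import Data.List using (List; []; _∷_; map; _++_; filter; length; foldr)
open import Data.Vec as Vec using (Vec; []; _∷_; zipWith)
import Data.Vec.Properties as VecP
import Data.Bool.Properties as BoolP
open import Data.Nat.Properties using (m^n≢0)
open import Data.Nat.Combinatorics using (_C_)
open import Data.Sum using (_⊎_)
open import Data.Product using (_×_; _,_; proj₁; proj₂)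
open import Relation.Nullary using (¬_; Dec; yes; no)
open import Relation.Nullary.Decidable using (¬?; _×-dec_)
open import Relation.Binary.PropositionalEquality using (_≡_)

F2 : ℕ → Set
F2 n = Vec Bool n

_≟v_ : ∀ {n} (x y : F2 n) → Dec (x ≡ y)
_≟v_ = VecP.≡-dec BoolP._≟_

_⊕_ : ∀ {n} → F2 n → F2 n → F2 n
_⊕_ = zipWith _xor_

allVecs : (n : ℕ) → List (F2 n)
allVecs ℕ.zero = [] ∷ []
allVecs (ℕ.suc n) = map (true ∷_) (allVecs n) ++ map (false ∷_) (allVecs n)

χ : ∀ {n} → F2 n → F2 n → ℤ
χ α x = if foldr _xor_ false (Vec.toList (zipWith _∧_ α x)) then - (+ 1) else + 1

sumℚ : List ℚ → ℚ
sumℚ = foldr ℚ._+_ ℚ.0ℚ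

fhat : ∀ {n} → (F2 n → ℤ) → F2 n → ℚ
fhat {n} f α = sumℚ (map (λ x → _/_ (f x ℤ.* χ α x) (2 ^ n) {{m^n≢0 2 n}}) (allVecs n))

support : ∀ {n} → (F2 n → ℤ) → List (F2 n)
support f = filter (λ α → ¬? (fhat f α ≟ ℚ.0ℚ)) (allVecs _)

sparsity : ∀ {n} → (F2 n → ℤ) → ℕ
sparsity f = length (support f)

pairs : ∀ {A : Set} → List A → List (A × A)
pairs [] = []
pairs (x ∷ xs) = map (x ,_) xs ++ pairs xs

-- |O_γ|: number of unordered pairs {α,β} ⊆ S, α ≠ β, with α + β = γ
Osize : ∀ {n} → (F2 n → ℤ) → F2 n → ℕ
Osize f γ = length (filter (λ p → (proj₁ p ⊕ proj₂ p) ≟v γ) (pairs (support f)))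

ℕtoℚ : ℕ → ℚ
ℕtoℚ m = (+ m) / 1

-- "m ≥ k^ℓ + 1" for a rational exponent ℓ = p/q ≥ 0 (p = numerator, q = denominator > 0):
-- equivalent to m ≥ 1 and (m - 1)^q ≥ k^p.
AtLeastPowPlusOne : ℕ → ℚ → ℕ → Set
AtLeastPowPlusOne k ℓ m = (1 ℕ.≤ m) × (k ^ ℤ.∣ ↥ ℓ ∣ ℕ.≤ (m ∸ 1) ^ (↧ₙ ℓ))

AtLeastPowPlusOne? : ∀ k ℓ m → Dec (AtLeastPowPlusOne k ℓ m)
AtLeastPowPlusOne? k ℓ m = (1 ℕ.≤? m) ×-dec (k ^ ℤ.∣ ↥ ℓ ∣ ℕ.≤? (m ∸ 1) ^ (↧ₙ ℓ))

Heavy : ∀ {n} → (F2 n → ℤ) → ℚ → F2 n → F2 n → Set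
Heavy f ℓ α β = AtLeastPowPlusOne (sparsity f) ℓ (Osize f (α ⊕ β))

Heavy? : ∀ {n} (f : F2 n → ℤ) ℓ α β → Dec (Heavy f ℓ α β)
Heavy? f ℓ α β = AtLeastPowPlusOne? (sparsity f) ℓ (Osize f (α ⊕ β))

heavyPairCount : ∀ {n} → (F2 n → ℤ) → ℚ → ℕ
heavyPairCount f ℓ = length (filter (λ p → Heavy? f ℓ (proj₁ p) (proj₂ p)) (pairs (support f)))

Folding : ∀ {n} → ℚ → ℚ → (F2 n → ℤ) → Set
Folding δ ℓ f = δ ℚ.* ℕtoℚ (sparsity f C 2) ℚ.≤ ℕtoℚ (heavyPairCount f ℓ)

heavyDeg : ∀ {n} → (F2 n → ℤ) → ℚ → F2 n → ℕ
heavyDeg f ℓ α = length (filter (λ β → ¬? (β ≟v α) ×-dec Heavy? f ℓ α β) (support f))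

Uset : ∀ {n} → ℚ → ℚ → (F2 n → ℤ) → List (F2 n)
Uset δ ℓ f = filter (λ α → (δ ℚ.* ℕtoℚ (sparsity f) ℚ.* (1ℤ / 2)) ≤? ℕtoℚ (heavyDeg f ℓ α)) (support f)
  where 1ℤ = + 1

IsBoolean : ∀ {n} → (F2 n → ℤ) → Set
IsBoolean {n} f = ∀ (x : F2 n) → (f x ≡ + 1) ⊎ (f x ≡ - (+ 1))

{-# OPTIONS --safe #-}
module Submission where

-- Regard the Fourier support S as a graph whose edges are the heavy pairs, i.e. the pairs
-- {α, β} with |O_{α+β}| ≥ k^ℓ + 1.  Folding says there are at least δ·C(k,2) edges, so the
-- degrees sum to at least δk(k−1).  A vertex outside U has degree below δk/2 and a vertex of
-- U has degree at most k, hence δk(k−1) ≤ k|U| + k·δk/2, i.e. |U| ≥ δ(k/2 − 1), which is at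
-- least δk/3 as soon as k ≥ 6.

open import Defs
open import Data.Nat as ℕ using (ℕ; zero; suc; _+_; _*_)
import Data.Nat.Properties as ℕP
open import Data.Nat.Combinatorics using (_C_; nC1≡n; nCk+nC[k+1]≡[n+1]C[k+1])
open import Data.Nat.ListAction using (sum)
open import Data.Nat.Solver renaming (module +-*-Solver to ℕ-Solver)
open import Data.Integer as ℤ using (ℤ; +_)
import Data.Integer.Properties as ℤP
open import Data.Rational as ℚ using (ℚ; _/_; 0ℚ; 1ℚ)
import Data.Rational.Properties as ℚP
import Data.Rational.Unnormalised as ℚᵘ
import Data.Rational.Unnormalised.Properties as ℚᵘP
open import Data.Rational.Literals using (fromℤ)
open import Data.Rational.Solver renaming (module +-*-Solver to ℚ-Solver)
open import Data.Bool using (true; false)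
import Data.Bool.Properties as BoolP
import Data.Vec as Vec
import Data.Vec.Properties as VecP
open import Data.List using (List; []; _∷_; map; filter; length; _++_)
import Data.List.Properties as LP
open import Data.List.Membership.Propositional using (_∈_)
open import Data.List.Membership.Propositional.Properties using (∈-map⁻)
open import Data.List.Relation.Unary.All as All using (All; []; _∷_)
open import Data.List.Relation.Unary.AllPairs using ([]; _∷_)
open import Data.List.Relation.Unary.Unique.Propositional using (Unique)
import Data.List.Relation.Unary.Unique.Propositional.Properties as Unique
open import Data.Product using (∃-syntax; _×_; _,_; proj₁; proj₂)
open import Function using (_∘_)
open import Function.Bundles using (_⇔_; mk⇔; Equivalence)
open import Level using (0ℓ)
open import Relation.Nullary using (¬_; Dec; yes; no; contradiction)
open import Relation.Nullary.Decidable using (¬?; _×-dec_)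
open import Relation.Unary using (Pred; Decidable)
open import Relation.Binary using (Rel; Symmetric)
open import Relation.Binary.Definitions using (DecidableEquality) renaming (Decidable to Decidable₂)
open import Relation.Binary.PropositionalEquality
open import Algebra.Bundles using (CommutativeMonoid)
import Algebra.Properties.CommutativeSemigroup as CommSemigroupProperties
open CommSemigroupProperties ℕP.+-commutativeSemigroup using (interchange)
open CommSemigroupProperties (CommutativeMonoid.commutativeSemigroup ℚP.*-1-commutativeMonoid) using (x∙yz≈y∙xz)

ℕtoℚ≡fromℤ : ∀ m → ℕtoℚ m ≡ fromℤ (+ m)
ℕtoℚ≡fromℤ m = ℚP.↥p/↧p≡p (fromℤ (+ m))

ℕtoℚ-homo-+ : ∀ m n → ℕtoℚ (m + n) ≡ ℕtoℚ m ℚ.+ ℕtoℚ n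
ℕtoℚ-homo-+ m n rewrite ℕtoℚ≡fromℤ (m + n) | ℕtoℚ≡fromℤ m | ℕtoℚ≡fromℤ n =
  ℚP.toℚᵘ-injective (ℚᵘP.≃-trans (ℚᵘ.*≡* cross) (ℚᵘP.≃-sym (ℚP.toℚᵘ-homo-+ (fromℤ (+ m)) (fromℤ (+ n)))))
  where
  cross : + (m + n) ℤ.* + 1 ≡ (+ m ℤ.* + 1 ℤ.+ + n ℤ.* + 1) ℤ.* + 1
  cross rewrite ℤP.*-identityʳ (+ m) | ℤP.*-identityʳ (+ n) = refl

ℕtoℚ-homo-* : ∀ m n → ℕtoℚ (m * n) ≡ ℕtoℚ m ℚ.* ℕtoℚ n
ℕtoℚ-homo-* m n rewrite ℕtoℚ≡fromℤ (m * n) | ℕtoℚ≡fromℤ m | ℕtoℚ≡fromℤ n =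
  ℚP.toℚᵘ-injective (ℚᵘP.≃-trans (ℚᵘ.*≡* (cong (ℤ._* + 1) (ℤP.pos-* m n)))
                                 (ℚᵘP.≃-sym (ℚP.toℚᵘ-homo-* (fromℤ (+ m)) (fromℤ (+ n)))))

ℕtoℚ-mono-≤ : ∀ {m n} → m ℕ.≤ n → ℕtoℚ m ℚ.≤ ℕtoℚ n
ℕtoℚ-mono-≤ {m} {n} m≤n rewrite ℕtoℚ≡fromℤ m | ℕtoℚ≡fromℤ n =
  ℚ.*≤* (ℤP.*-monoʳ-≤-nonNeg (+ 1) (ℤ.+≤+ m≤n))

ℕtoℚ-nonNeg : ∀ m → 0ℚ ℚ.≤ ℕtoℚ m
ℕtoℚ-nonNeg m = ℚP.nonNegative⁻¹ (ℕtoℚ m) {{ℚP.normalize-nonNeg m 1}}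

ℕtoℚ-positive : ∀ m → ℚ.Positive (ℕtoℚ (suc m))
ℕtoℚ-positive m = ℚP.normalize-pos (suc m) 1

p≤p+q : ∀ {p q} → 0ℚ ℚ.≤ q → p ℚ.≤ p ℚ.+ q
p≤p+q {p} {q} 0≤q = begin
  p          ≡⟨ ℚP.+-identityʳ p ⟨
  p ℚ.+ 0ℚ   ≤⟨ ℚP.+-monoʳ-≤ p 0≤q ⟩
  p ℚ.+ q    ∎
  where open ℚP.≤-Reasoning

*-nonNeg : ∀ {p q} → 0ℚ ℚ.≤ p → 0ℚ ℚ.≤ q → 0ℚ ℚ.≤ p ℚ.* q
*-nonNeg {p} {q} 0≤p 0≤q =
  ℚP.nonNegative⁻¹ _ {{ℚP.nonNeg*nonNeg⇒nonNeg p {{ℚ.nonNegative 0≤p}} q {{ℚ.nonNegative 0≤q}}}}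

½ ⅓ ⅙ : ℚ
½ = + 1 / 2
⅓ = + 1 / 3
⅙ = + 1 / 6

2*[1+n]C2≡[1+n]*n : ∀ n → 2 * (suc n C 2) ≡ suc n * n
2*[1+n]C2≡[1+n]*n zero    = refl
2*[1+n]C2≡[1+n]*n (suc n) = begin
  2 * (suc (suc n) C 2)               ≡⟨ cong (2 *_) (nCk+nC[k+1]≡[n+1]C[k+1] (suc n) 1) ⟨
  2 * (suc n C 1 + suc n C 2)         ≡⟨ ℕP.*-distribˡ-+ 2 (suc n C 1) (suc n C 2) ⟩
  2 * (suc n C 1) + 2 * (suc n C 2)   ≡⟨ cong₂ (λ a b → 2 * a + b) (nC1≡n (suc n)) (2*[1+n]C2≡[1+n]*n n) ⟩
  2 * suc n + suc n * n               ≡⟨ solve 1 (λ n → con 2 :* (con 1 :+ n) :+ (con 1 :+ n) :* n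
                                                   := (con 2 :+ n) :* (con 1 :+ n)) refl n ⟩
  suc (suc n) * suc n                 ∎
  where open ≡-Reasoning
        open ℕ-Solver

δ[k-1]≤u+δk/2⇒δk/3≤u : ∀ {δ u : ℚ} m → 0ℚ ℚ.≤ δ →
  δ ℚ.* ℕtoℚ (5 + m) ℚ.≤ u ℚ.+ δ ℚ.* ℕtoℚ (6 + m) ℚ.* ½ → δ ℚ.* ℕtoℚ (6 + m) ℚ.* ⅓ ℚ.≤ u
δ[k-1]≤u+δk/2⇒δk/3≤u {δ} {u} m 0≤δ rewrite ℕtoℚ-homo-+ 5 m | ℕtoℚ-homo-+ 6 m = λ hyp → begin
  δ ℚ.* k ℚ.* ⅓
    ≤⟨ p≤p+q (*-nonNeg (*-nonNeg 0≤δ (ℕtoℚ-nonNeg m)) (ℚP.nonNegative⁻¹ ⅙)) ⟩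
  δ ℚ.* k ℚ.* ⅓ ℚ.+ δ ℚ.* M ℚ.* ⅙
    ≡⟨ solve 2 (λ δ M → δ :* (con (ℕtoℚ 6) :+ M) :* con ⅓ :+ δ :* M :* con ⅙
                      := δ :* (con (ℕtoℚ 5) :+ M) :- δ :* (con (ℕtoℚ 6) :+ M) :* con ½) refl δ M ⟩
  δ ℚ.* (ℕtoℚ 5 ℚ.+ M) ℚ.- δ ℚ.* k ℚ.* ½
    ≤⟨ ℚP.+-monoˡ-≤ (ℚ.- (δ ℚ.* k ℚ.* ½)) hyp ⟩
  u ℚ.+ δ ℚ.* k ℚ.* ½ ℚ.- δ ℚ.* k ℚ.* ½
    ≡⟨ solve 2 (λ u x → u :+ x :- x := u) refl u (δ ℚ.* k ℚ.* ½) ⟩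
  u ∎
  where
  open ℚP.≤-Reasoning
  open ℚ-Solver
  M = ℕtoℚ m
  k = ℕtoℚ 6 ℚ.+ M

edge-bounds⇒δk/3≤u : ∀ {δ : ℚ} {k u h : ℕ} → 0ℚ ℚ.≤ δ → 6 ℕ.≤ k →
  δ ℚ.* ℕtoℚ (k C 2) ℚ.≤ ℕtoℚ h →
  ℕtoℚ (2 * h) ℚ.≤ ℕtoℚ k ℚ.* ℕtoℚ u ℚ.+ ℕtoℚ k ℚ.* (δ ℚ.* ℕtoℚ k ℚ.* ½) →
  δ ℚ.* ℕtoℚ k ℚ.* ⅓ ℚ.≤ ℕtoℚ u
edge-bounds⇒δk/3≤u {δ} {k} {u} {h} 0≤δ 6≤k δ[kC2]≤h 2h≤ku+kc with ℕP.m≤n⇒∃[o]m+o≡n 6≤k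
... | m , refl = δ[k-1]≤u+δk/2⇒δk/3≤u m 0≤δ
  (ℚP.*-cancelˡ-≤-pos K {{ℕtoℚ-positive (5 + m)}} (begin
    K ℚ.* (δ ℚ.* ℕtoℚ (5 + m))      ≡⟨ x∙yz≈y∙xz K δ (ℕtoℚ (5 + m)) ⟩
    δ ℚ.* (K ℚ.* ℕtoℚ (5 + m))      ≡⟨ cong (δ ℚ.*_) (ℕtoℚ-homo-* k (5 + m)) ⟨
    δ ℚ.* ℕtoℚ (k * (5 + m))        ≡⟨ cong (λ n → δ ℚ.* ℕtoℚ n) (2*[1+n]C2≡[1+n]*n (5 + m)) ⟨
    δ ℚ.* ℕtoℚ (2 * (k C 2))        ≡⟨ cong (δ ℚ.*_) (ℕtoℚ-homo-* 2 (k C 2)) ⟩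
    δ ℚ.* (ℕtoℚ 2 ℚ.* C₂)           ≡⟨ x∙yz≈y∙xz δ (ℕtoℚ 2) C₂ ⟩
    ℕtoℚ 2 ℚ.* (δ ℚ.* C₂)           ≤⟨ ℚP.*-monoˡ-≤-nonNeg (ℕtoℚ 2) δ[kC2]≤h ⟩
    ℕtoℚ 2 ℚ.* ℕtoℚ h               ≡⟨ ℕtoℚ-homo-* 2 h ⟨
    ℕtoℚ (2 * h)                    ≤⟨ 2h≤ku+kc ⟩
    K ℚ.* ℕtoℚ u ℚ.+ K ℚ.* c        ≡⟨ ℚP.*-distribˡ-+ K (ℕtoℚ u) c ⟨
    K ℚ.* (ℕtoℚ u ℚ.+ c)            ∎))
  where
  open ℚP.≤-Reasoning
  K = ℕtoℚ k
  C₂ = ℕtoℚ (k C 2)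
  c = δ ℚ.* K ℚ.* ½

indicator : ∀ {P : Set} → Dec P → ℕ
indicator (yes _) = 1
indicator (no _)  = 0

indicator-cong : ∀ {P Q : Set} → P ⇔ Q → (p? : Dec P) (q? : Dec Q) → indicator p? ≡ indicator q?
indicator-cong P⇔Q (yes _) (yes _) = refl
indicator-cong P⇔Q (yes p) (no ¬q) = contradiction (Equivalence.to P⇔Q p) ¬q
indicator-cong P⇔Q (no ¬p) (yes q) = contradiction (Equivalence.from P⇔Q q) ¬p
indicator-cong P⇔Q (no _)  (no _)  = refl

below-threshold : ∀ {x b c : ℚ} (c≤x? : Dec (c ℚ.≤ x)) → 0ℚ ℚ.≤ c → x ℚ.≤ b →
                  x ℚ.≤ b ℚ.* ℕtoℚ (indicator c≤x?) ℚ.+ c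
below-threshold {x} {b} {c} (yes _) 0≤c x≤b = begin
  x                  ≤⟨ x≤b ⟩
  b                  ≡⟨ ℚP.*-identityʳ b ⟨
  b ℚ.* 1ℚ           ≤⟨ p≤p+q 0≤c ⟩
  b ℚ.* 1ℚ ℚ.+ c     ∎
  where open ℚP.≤-Reasoning
below-threshold {x} {b} {c} (no c≰x) _ _ = begin
  x                  ≤⟨ ℚP.<⇒≤ (ℚP.≰⇒> c≰x) ⟩
  c                  ≡⟨ ℚP.+-identityˡ c ⟨
  0ℚ ℚ.+ c           ≡⟨ cong (ℚ._+ c) (ℚP.*-zeroʳ b) ⟨
  b ℚ.* 0ℚ ℚ.+ c     ∎
  where open ℚP.≤-Reasoning

module _ {A : Set} where

  count : {P : Pred A 0ℓ} → Decidable P → List A → ℕ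
  count P? xs = length (filter P? xs)

  count-∷ : ∀ {P : Pred A 0ℓ} (P? : Decidable P) x xs → count P? (x ∷ xs) ≡ indicator (P? x) + count P? xs
  count-∷ P? x xs with P? x
  ... | yes _ = refl
  ... | no _  = refl

  count-cong : ∀ {P Q : Pred A 0ℓ} (P? : Decidable P) (Q? : Decidable Q) {xs} →
               All (λ x → P x ⇔ Q x) xs → count P? xs ≡ count Q? xs
  count-cong P? Q? {[]}     []            = refl
  count-cong P? Q? {x ∷ xs} (P⇔Q ∷ P⇔Qs) = begin
    count P? (x ∷ xs)                ≡⟨ count-∷ P? x xs ⟩
    indicator (P? x) + count P? xs   ≡⟨ cong₂ _+_ (indicator-cong P⇔Q (P? x) (Q? x)) (count-cong P? Q? P⇔Qs) ⟩
    indicator (Q? x) + count Q? xs   ≡⟨ count-∷ Q? x xs ⟨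
    count Q? (x ∷ xs)                ∎
    where open ≡-Reasoning

module _ {A : Set} (g : A → ℕ) {c : ℚ} (reaches? : Decidable (λ a → c ℚ.≤ ℕtoℚ (g a))) where

  sum-≤-threshold : ∀ {b} → (∀ a → g a ℕ.≤ b) → 0ℚ ℚ.≤ c → ∀ xs →
    ℕtoℚ (sum (map g xs)) ℚ.≤ ℕtoℚ b ℚ.* ℕtoℚ (count reaches? xs) ℚ.+ ℕtoℚ (length xs) ℚ.* c
  sum-≤-threshold {b} g≤b 0≤c [] =
    ℚP.≤-reflexive (solve 2 (λ B c → con 0ℚ := B :* con 0ℚ :+ con 0ℚ :* c) refl (ℕtoℚ b) c)
    where open ℚ-Solver
  sum-≤-threshold {b} g≤b 0≤c (x ∷ xs) = begin
    ℕtoℚ (g x + sum (map g xs))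
      ≡⟨ ℕtoℚ-homo-+ (g x) _ ⟩
    ℕtoℚ (g x) ℚ.+ ℕtoℚ (sum (map g xs))
      ≤⟨ ℚP.+-mono-≤ (below-threshold (reaches? x) 0≤c (ℕtoℚ-mono-≤ (g≤b x))) (sum-≤-threshold g≤b 0≤c xs) ⟩
    (B ℚ.* I ℚ.+ c) ℚ.+ (B ℚ.* N ℚ.+ L ℚ.* c)
      ≡⟨ solve 5 (λ B I N L c → (B :* I :+ c) :+ (B :* N :+ L :* c) := B :* (I :+ N) :+ (con 1ℚ :+ L) :* c)
               refl B I N L c ⟩
    B ℚ.* (I ℚ.+ N) ℚ.+ (1ℚ ℚ.+ L) ℚ.* c
      ≡⟨ cong₂ (λ i l → B ℚ.* i ℚ.+ l ℚ.* c) (ℕtoℚ-homo-+ (indicator (reaches? x)) (count reaches? xs))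
                                             (ℕtoℚ-homo-+ 1 (length xs)) ⟨
    B ℚ.* ℕtoℚ (indicator (reaches? x) + count reaches? xs) ℚ.+ ℕtoℚ (suc (length xs)) ℚ.* c
      ≡⟨ cong (λ n → B ℚ.* ℕtoℚ n ℚ.+ ℕtoℚ (suc (length xs)) ℚ.* c) (count-∷ reaches? x xs) ⟨
    B ℚ.* ℕtoℚ (count reaches? (x ∷ xs)) ℚ.+ ℕtoℚ (length (x ∷ xs)) ℚ.* c
      ∎
    where
    open ℚP.≤-Reasoning
    open ℚ-Solver
    B = ℕtoℚ b
    I = ℕtoℚ (indicator (reaches? x))
    N = ℕtoℚ (count reaches? xs)
    L = ℕtoℚ (length xs)

module SimpleGraph {A : Set} (_≟_ : DecidableEquality A)
                   {R : Rel A 0ℓ} (R? : Decidable₂ R) (R-sym : Symmetric R) where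

  degree : List A → A → ℕ
  degree xs x = count (λ y → ¬? (y ≟ x) ×-dec R? x y) xs

  edgeCount : List A → ℕ
  edgeCount xs = count (λ p → R? (proj₁ p) (proj₂ p)) (pairs xs)

  edgeCount-∷ : ∀ x ys → edgeCount (x ∷ ys) ≡ count (R? x) ys + edgeCount ys
  edgeCount-∷ x ys = begin
    edgeCount (x ∷ ys)
      ≡⟨ cong length (LP.filter-++ R?′ (map (x ,_) ys) (pairs ys)) ⟩
    length (filter R?′ (map (x ,_) ys) ++ filter R?′ (pairs ys))
      ≡⟨ LP.length-++ (filter R?′ (map (x ,_) ys)) ⟩
    count R?′ (map (x ,_) ys) + edgeCount ys
      ≡⟨ cong (_+ edgeCount ys) (count-edges-at ys) ⟩
    count (R? x) ys + edgeCount ys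
      ∎
    where
    open ≡-Reasoning
    R?′ = λ p → R? (proj₁ p) (proj₂ p)
    count-edges-at : ∀ zs → count R?′ (map (x ,_) zs) ≡ count (R? x) zs
    count-edges-at []       = refl
    count-edges-at (z ∷ zs) with R? x z
    ... | yes _ = cong suc (count-edges-at zs)
    ... | no _  = count-edges-at zs

  degree-self : ∀ x ys → degree (x ∷ ys) x ≡ degree ys x
  degree-self x ys with x ≟ x
  ... | yes _  = refl
  ... | no x≢x = contradiction refl x≢x

  degree-fresh : ∀ {x ys} → All (x ≢_) ys → degree ys x ≡ count (R? x) ys
  degree-fresh = count-cong _ (R? _) ∘ All.map (λ x≢y → mk⇔ proj₂ (λ r → (x≢y ∘ sym) , r))

  degree-∷ : ∀ {x y} ys → x ≢ y → degree (x ∷ ys) y ≡ indicator (R? x y) + degree ys y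
  degree-∷ {x} {y} ys x≢y = trans (count-∷ (λ z → ¬? (z ≟ y) ×-dec R? y z) x ys)
    (cong (_+ degree ys y)
          (indicator-cong (mk⇔ (R-sym ∘ proj₂) (λ r → x≢y , R-sym r)) (¬? (x ≟ y) ×-dec R? y x) (R? x y)))

  sum-degree-∷ : ∀ {x} ys {zs} → All (x ≢_) zs →
                 sum (map (degree (x ∷ ys)) zs) ≡ count (R? x) zs + sum (map (degree ys) zs)
  sum-degree-∷ ys {[]}         []             = refl
  sum-degree-∷ {x} ys {z ∷ zs} (x≢z ∷ x∉zs) = begin
    degree (x ∷ ys) z + sum (map (degree (x ∷ ys)) zs)
      ≡⟨ cong₂ _+_ (degree-∷ ys x≢z) (sum-degree-∷ ys x∉zs) ⟩
    (indicator (R? x z) + degree ys z) + (count (R? x) zs + sum (map (degree ys) zs))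
      ≡⟨ interchange (indicator (R? x z)) _ _ _ ⟩
    (indicator (R? x z) + count (R? x) zs) + sum (map (degree ys) (z ∷ zs))
      ≡⟨ cong (_+ sum (map (degree ys) (z ∷ zs))) (count-∷ (R? x) z zs) ⟨
    count (R? x) (z ∷ zs) + sum (map (degree ys) (z ∷ zs))
      ∎
    where open ≡-Reasoning

  sum-degree≡2*edgeCount : ∀ xs → Unique xs → sum (map (degree xs) xs) ≡ 2 * edgeCount xs
  sum-degree≡2*edgeCount []       []               = refl
  sum-degree≡2*edgeCount (x ∷ ys) (x∉ys ∷ ys-uniq) = begin
    degree (x ∷ ys) x + sum (map (degree (x ∷ ys)) ys)
      ≡⟨ cong₂ _+_ (trans (degree-self x ys) (degree-fresh x∉ys)) (sum-degree-∷ ys x∉ys) ⟩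
    d + (d + sum (map (degree ys) ys))
      ≡⟨ cong (λ s → d + (d + s)) (sum-degree≡2*edgeCount ys ys-uniq) ⟩
    d + (d + 2 * edgeCount ys)
      ≡⟨ solve 2 (λ d e → d :+ (d :+ con 2 :* e) := con 2 :* (d :+ e)) refl d (edgeCount ys) ⟩
    2 * (d + edgeCount ys)
      ≡⟨ cong (2 *_) (edgeCount-∷ x ys) ⟨
    2 * edgeCount (x ∷ ys)
      ∎
    where
    open ≡-Reasoning
    open ℕ-Solver
    d = count (R? x) ys

  -- high? is implicit so that it is read off the caller's goal as written: matching it against
  -- a decider fixed here would make Agda unfold the gcd normalisation of ℚ, which is very slow.
  dense⇒many-high-degree :
    ∀ {δ} xs {high? : Decidable (λ x → δ ℚ.* ℕtoℚ (length xs) ℚ.* ½ ℚ.≤ ℕtoℚ (degree xs x))} →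
    Unique xs → 0ℚ ℚ.≤ δ → 6 ℕ.≤ length xs → δ ℚ.* ℕtoℚ (length xs C 2) ℚ.≤ ℕtoℚ (edgeCount xs) →
    δ ℚ.* ℕtoℚ (length xs) ℚ.* ⅓ ℚ.≤ ℕtoℚ (count high? xs)
  dense⇒many-high-degree {δ} xs {high?} xs-uniq 0≤δ 6≤k dense =
    edge-bounds⇒δk/3≤u {u = count high? xs} {h = edgeCount xs} 0≤δ 6≤k dense (begin
    ℕtoℚ (2 * edgeCount xs)           ≡⟨ cong ℕtoℚ (sum-degree≡2*edgeCount xs xs-uniq) ⟨
    ℕtoℚ (sum (map (degree xs) xs))   ≤⟨ sum-≤-threshold (degree xs) high? degree≤k 0≤c xs ⟩
    K ℚ.* ℕtoℚ (count high? xs) ℚ.+ K ℚ.* c ∎)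
    where
    open ℚP.≤-Reasoning
    K = ℕtoℚ (length xs)
    c = δ ℚ.* K ℚ.* ½
    0≤c : 0ℚ ℚ.≤ c
    0≤c = *-nonNeg (*-nonNeg 0≤δ (ℕtoℚ-nonNeg (length xs))) (ℚP.nonNegative⁻¹ ½)
    degree≤k : ∀ x → degree xs x ℕ.≤ length xs
    degree≤k x = LP.length-filter _ xs

allVecs-unique : ∀ n → Unique (allVecs n)
allVecs-unique zero    = [] ∷ []
allVecs-unique (suc n) = Unique.++⁺ (Unique.map⁺ VecP.∷-injectiveʳ (allVecs-unique n))
                                    (Unique.map⁺ VecP.∷-injectiveʳ (allVecs-unique n)) disjoint
  where
  disjoint : ∀ {v : F2 (suc n)} → ¬ (v ∈ map (true Vec.∷_) (allVecs n) × v ∈ map (false Vec.∷_) (allVecs n))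
  disjoint (v∈true∷ , v∈false∷) with ∈-map⁻ (true Vec.∷_) v∈true∷ | ∈-map⁻ (false Vec.∷_) v∈false∷
  ... | _ , _ , refl | _ , _ , ()

support-unique : ∀ {n} (f : F2 n → ℤ) → Unique (support f)
support-unique {n} f = Unique.filter⁺ _ (allVecs-unique n)

Heavy-sym : ∀ {n} (f : F2 n → ℤ) ℓ → Symmetric (Heavy f ℓ)
Heavy-sym f ℓ {α} {β} =
  subst (AtLeastPowPlusOne (sparsity f) ℓ ∘ Osize f) (VecP.zipWith-comm BoolP.xor-comm α β)

claim1 : (δ ℓ : ℚ) → 0ℚ ℚ.< δ → δ ℚ.≤ 1ℚ → 0ℚ ℚ.≤ ℓ →
    ∃[ K ] ((n : ℕ) (f : F2 n → ℤ) → IsBoolean f → K ℕ.≤ sparsity f → Folding δ ℓ f →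
    δ ℚ.* ℕtoℚ (sparsity f) ℚ.* ((+ 1) / 3) ℚ.≤ ℕtoℚ (length (Uset δ ℓ f)))
claim1 δ ℓ 0<δ _ _ = 6 , λ n f _ 6≤k folding →
  SimpleGraph.dense⇒many-high-degree _≟v_ (Heavy? f ℓ) (Heavy-sym f ℓ)
    (support f) (support-unique f) (ℚP.<⇒≤ 0<δ) 6≤k folding
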